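{- Consider the following eight two-vertex Boolean networks $(f_1,f_2)$: $[1,00,11]$: $f_1=f_2=x_1\land x_2$; $[2,00,11]$: $f_1=x_1\land x_2,f_2=x_1$; $[3,00,11]$: $f_1=f_2=x_1$; $[4,00,11]$: $f_1=x_2,f_2=x_1\land x_2$; $[6,00,11]$: $f_1=x_1\lor x_2,f_2=x_1$; $[7,00,11]$: $f_1=f_2=x_2$; $[8,00,11]$: $f_1=x_2,f_2=x_1\lor x_2$; $[9,00,11]$: $f_1=f_2=x_1\lor x_2$. For any delay vector $(\alpha,\beta)$, every MBN built on one of these networks has exactly two attractors, the fixed points $(0,0)$ and $(\alpha,\beta)$.
   Context: The MBN built on a two-vertex Boolean network $(f_1,f_2)$ with delay vector $(\alpha,\beta)$ of positive integers has configurations $(\rho,\gamma)$ with $0\le\rho\le\alpha$, $0\le\gamma\le\beta$, underlying Boolean state $x=([\rho\ge1],[\gamma\ge1])$, and dynamics: the first coordinate becomes $\alpha$ if $f_1(x)=1$, else $\max(\rho-1,0)$; the second becomes $\beta$ if $f_2(x)=1$, else $\max(\gamma-1,0)$. Attractors are periodic orbits: fixed points (length 1) and limit cycles (length $\ge2$). -}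

module Defs where

open import Data.Bool using (Bool; true; false; _∧_; _∨_; if_then_else_)
open import Data.Nat using (ℕ; zero; suc; _∸_; _≤_; _≤ᵇ_; _≥_)
open import Data.Nat.Properties using ()
open import Data.Product using (_×_; _,_; Σ; ∃; proj₁; proj₂)
open import Data.Sum using (_⊎_)
open import Data.Fin using (Fin; zero; suc)
open import Relation.Binary.PropositionalEquality using (_≡_)

BN2 : Set
BN2 = (Bool → Bool → Bool) × (Bool → Bool → Bool)

-- The eight networks of the statement (in the order listed).
-- 0:[1,00,11] 1:[2,00,11] 2:[3,00,11] 3:[4,00,11]
-- 4:[6,00,11] 5:[7,00,11] 6:[8,00,11] 7:[9,00,11]
network : Fin 8 → BN2
network zero                                   = (λ x₁ x₂ → x₁ ∧ x₂) , (λ x₁ x₂ → x₁ ∧ x₂)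
network (suc zero)                             = (λ x₁ x₂ → x₁ ∧ x₂) , (λ x₁ x₂ → x₁)
network (suc (suc zero))                       = (λ x₁ x₂ → x₁) , (λ x₁ x₂ → x₁)
network (suc (suc (suc zero)))                 = (λ x₁ x₂ → x₂) , (λ x₁ x₂ → x₁ ∧ x₂)
network (suc (suc (suc (suc zero))))           = (λ x₁ x₂ → x₁ ∨ x₂) , (λ x₁ x₂ → x₁)
network (suc (suc (suc (suc (suc zero)))))     = (λ x₁ x₂ → x₂) , (λ x₁ x₂ → x₂)
network (suc (suc (suc (suc (suc (suc zero)))))) = (λ x₁ x₂ → x₂) , (λ x₁ x₂ → x₁ ∨ x₂)
network (suc (suc (suc (suc (suc (suc (suc zero))))))) = (λ x₁ x₂ → x₁ ∨ x₂) , (λ x₁ x₂ → x₁ ∨ x₂)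

Config : Set
Config = ℕ × ℕ

Valid : ℕ → ℕ → Config → Set
Valid α β (ρ , γ) = ρ ≤ α × γ ≤ β

pos : ℕ → Bool
pos zero    = false
pos (suc _) = true

state : Config → Bool × Bool
state (ρ , γ) = pos ρ , pos γ

-- one MBN step with delay vector (α , β); note max(ρ-1,0) = ρ ∸ 1
step : BN2 → ℕ → ℕ → Config → Config
step (f₁ , f₂) α β (ρ , γ) =
  (if f₁ (pos ρ) (pos γ) then α else ρ ∸ 1) ,
  (if f₂ (pos ρ) (pos γ) then β else γ ∸ 1)

iter : (Config → Config) → ℕ → Config → Config
iter F zero    c = c
iter F (suc n) c = F (iter F n c)

-- c lies on a periodic orbit (i.e. belongs to some attractor)
Periodic : BN2 → ℕ → ℕ → Config → Set
Periodic f α β c = Σ ℕ λ k → iter (step f α β) (suc k) c ≡ c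

FixedPoint : BN2 → ℕ → ℕ → Config → Set
FixedPoint f α β c = step f α β c ≡ c

{-# OPTIONS --safe #-}
-- Both extreme configurations (0 , 0) and (α , β) are fixed, and from every
-- configuration the dynamics reaches one of them in finitely many steps: a
-- vertex whose function is on saturates to its delay, while the counters of
-- the others decay to 0.  A periodic point c of period k + 1 equals
-- iter F k (F c), so whatever forward-invariant set F c eventually enters
-- already contains c; by induction along the run, c is one of the two
-- fixed points.
module Submission where

open import Defs
open import Data.Nat using (ℕ; _≤_; zero; suc; s≤s)
open import Data.Fin using (Fin)
open import Data.Fin.Patterns using (0F; 1F; 2F; 3F; 4F; 5F; 6F; 7F)
open import Data.Product using (_×_; _,_)
open import Data.Sum using (_⊎_; inj₁; inj₂)
open import Relation.Binary.PropositionalEquality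
  using (_≡_; _≢_; refl; sym; subst; cong)

module _ (F : Config → Config) where

  data Eventually (P : Config → Set) : Config → Set where
    now   : ∀ {c} → P c → Eventually P c
    later : ∀ {c} → Eventually P (F c) → Eventually P c

  Invariant : (Config → Set) → Set
  Invariant P = ∀ {x} → P x → P (F x)

  iter-suc : ∀ n c → iter F (suc n) c ≡ iter F n (F c)
  iter-suc zero    c = refl
  iter-suc (suc n) c = cong F (iter-suc n c)

  iter-invariant : ∀ P → Invariant P → ∀ n {c} → P c → P (iter F n c)
  iter-invariant P inv zero    p = p
  iter-invariant P inv (suc n) p = inv (iter-invariant P inv n p)

  periodic-in-invariant : ∀ P → Invariant P → ∀ {c} → Eventually P c →
                          ∀ k → iter F (suc k) c ≡ c → P c
  periodic-in-invariant P inv (now p) k periodic = p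
  periodic-in-invariant P inv {c} (later e) k periodic =
    subst P periodic′
      (iter-invariant P inv k (periodic-in-invariant P inv e k (cong F periodic′)))
    where
    periodic′ : iter F k (F c) ≡ c
    periodic′ = subst (_≡ c) (iter-suc k c) periodic

  fixed-pair-invariant : ∀ {p q} → F p ≡ p → F q ≡ q →
                         Invariant (λ x → x ≡ p ⊎ x ≡ q)
  fixed-pair-invariant fp fq (inj₁ refl) = inj₁ fp
  fixed-pair-invariant fp fq (inj₂ refl) = inj₂ fq

  first-decays : ∀ {P} → (∀ ρ → F (suc ρ , 0) ≡ (ρ , 0)) →
                 P (0 , 0) → ∀ ρ → Eventually P (ρ , 0)
  first-decays decay p zero    = now p
  first-decays decay p (suc ρ) =
    later (subst (Eventually _) (sym (decay ρ)) (first-decays decay p ρ))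

  second-decays : ∀ {P} → (∀ γ → F (0 , suc γ) ≡ (0 , γ)) →
                  P (0 , 0) → ∀ γ → Eventually P (0 , γ)
  second-decays decay p zero    = now p
  second-decays decay p (suc γ) =
    later (subst (Eventually _) (sym (decay γ)) (second-decays decay p γ))

Extreme : ℕ → ℕ → Config → Set
Extreme α β c = c ≡ (0 , 0) ⊎ c ≡ (α , β)

extremes-fixed : (i : Fin 8) (a b : ℕ) →
                 FixedPoint (network i) (suc a) (suc b) (0 , 0) ×
                 FixedPoint (network i) (suc a) (suc b) (suc a , suc b)
extremes-fixed 0F a b = refl , refl
extremes-fixed 1F a b = refl , refl
extremes-fixed 2F a b = refl , refl
extremes-fixed 3F a b = refl , refl
extremes-fixed 4F a b = refl , refl
extremes-fixed 5F a b = refl , refl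
extremes-fixed 6F a b = refl , refl
extremes-fixed 7F a b = refl , refl

reaches-extreme : (i : Fin 8) (a b : ℕ) (c : Config) →
                  Eventually (step (network i) (suc a) (suc b))
                             (Extreme (suc a) (suc b)) c
reaches-extreme 0F a b (ρ , zero)            = first-decays _ (λ _ → refl) (inj₁ refl) ρ
reaches-extreme 0F a b (zero , γ)            = second-decays _ (λ _ → refl) (inj₁ refl) γ
reaches-extreme 0F a b (suc ρ , suc γ)       = later (now (inj₂ refl))
reaches-extreme 1F a b (zero , γ)            = second-decays _ (λ _ → refl) (inj₁ refl) γ
reaches-extreme 1F a b (suc zero , zero)     = later (second-decays _ (λ _ → refl) (inj₁ refl) (suc b))
reaches-extreme 1F a b (suc (suc ρ) , zero)  = later (later (now (inj₂ refl)))
reaches-extreme 1F a b (suc ρ , suc γ)       = later (now (inj₂ refl))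
reaches-extreme 2F a b (zero , γ)            = second-decays _ (λ _ → refl) (inj₁ refl) γ
reaches-extreme 2F a b (suc ρ , γ)           = later (now (inj₂ refl))
reaches-extreme 3F a b (ρ , zero)            = first-decays _ (λ _ → refl) (inj₁ refl) ρ
reaches-extreme 3F a b (zero , suc zero)     = later (first-decays _ (λ _ → refl) (inj₁ refl) (suc a))
reaches-extreme 3F a b (zero , suc (suc γ))  = later (later (now (inj₂ refl)))
reaches-extreme 3F a b (suc ρ , suc γ)       = later (now (inj₂ refl))
reaches-extreme 4F a b (zero , zero)         = now (inj₁ refl)
reaches-extreme 4F a b (zero , suc γ)        = later (later (now (inj₂ refl)))
reaches-extreme 4F a b (suc ρ , γ)           = later (now (inj₂ refl))
reaches-extreme 5F a b (ρ , zero)            = first-decays _ (λ _ → refl) (inj₁ refl) ρ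
reaches-extreme 5F a b (ρ , suc γ)           = later (now (inj₂ refl))
reaches-extreme 6F a b (zero , zero)         = now (inj₁ refl)
reaches-extreme 6F a b (suc zero , zero)     = later (later (now (inj₂ refl)))
reaches-extreme 6F a b (suc (suc ρ) , zero)  = later (later (now (inj₂ refl)))
reaches-extreme 6F a b (zero , suc γ)        = later (now (inj₂ refl))
reaches-extreme 6F a b (suc ρ , suc γ)       = later (now (inj₂ refl))
reaches-extreme 7F a b (zero , zero)         = now (inj₁ refl)
reaches-extreme 7F a b (zero , suc γ)        = later (now (inj₂ refl))
reaches-extreme 7F a b (suc ρ , γ)           = later (now (inj₂ refl))

proposition12 : (i : Fin 8) (α β : ℕ) → 1 ≤ α → 1 ≤ β →
    FixedPoint (network i) α β (0 , 0) ×
    FixedPoint (network i) α β (α , β) ×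
    (0 , 0) ≢ (α , β) ×
    ((c : Config) → Valid α β c →
      (Periodic (network i) α β c → (c ≡ (0 , 0) ⊎ c ≡ (α , β))) ×
      ((c ≡ (0 , 0) ⊎ c ≡ (α , β)) → Periodic (network i) α β c))
proposition12 i (suc a) (suc b) (s≤s _) (s≤s _) =
  origin-fixed , full-fixed , (λ ()) , λ c _ →
    (λ (k , periodic) →
       periodic-in-invariant F (Extreme (suc a) (suc b))
         (fixed-pair-invariant F origin-fixed full-fixed)
         (reaches-extreme i a b c) k periodic) ,
    λ { (inj₁ refl) → 0 , origin-fixed ; (inj₂ refl) → 0 , full-fixed }
  where
  F : Config → Config
  F = step (network i) (suc a) (suc b)

  origin-fixed : F (0 , 0) ≡ (0 , 0)
  origin-fixed = let (fixed , _) = extremes-fixed i a b in fixed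

  full-fixed : F (suc a , suc b) ≡ (suc a , suc b)
  full-fixed = let (_ , fixed) = extremes-fixed i a b in fixed
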